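{- Let $p \geq 1$, $c = 2p+1$, and let $n \geq m \geq 1$ be integers with $n \geq p+1$. Consider a red/blue coloring of the edges of $K_{2(n+m+p)-1}$ and a vertex $u$ with $|R(u)| \geq |R(v)|$ and $|R(u)| \geq |B(v)|$ for every vertex $v$. Let $A = R(u)$ and define $k$ by $|A| = n+m+p-1+k$. If $k \geq p+1$ and there is a red cycle on $2p$ vertices all of which lie in $A$, then the coloring contains a monochromatic copy of $S_c(n,m)$.
   Context: For a vertex $v$, $R(v)$ (resp. $B(v)$) denotes the set of vertices joined to $v$ by a red (resp. blue) edge. For integers $n \geq m \geq 0$ and $c \geq 1$, the linked double star $S_c(n,m)$ is the graph on vertices $a_1,\dots,a_c, v_1,\dots,v_n, w_1,\dots,w_m$ with edges $a_1v_i$ ($1\le i\le n$), $a_ja_{j+1}$ ($1 \le j \le c-1$) and $a_cw_j$ ($1\le j\le m$). Lengths of cycles are measured by number of vertices. -}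

module Defs where

open import Data.Nat using (ℕ; zero; suc; _+_; _*_; _∸_; _≤_)
open import Data.Fin using (Fin; zero; suc; inject₁; fromℕ; toℕ)
open import Data.List using (length; filter)
open import Data.List.Base using (allFin)
open import Data.Product using (Σ; _×_; _,_)
open import Data.Sum using (_⊎_)
open import Relation.Binary.PropositionalEquality using (_≡_; _≢_; refl)
open import Relation.Nullary using (Dec; yes; no; ¬?)
open import Relation.Nullary.Decidable using (_×-dec_)
open import Function.Definitions using (Injective)
import Data.Fin.Properties as FinP

data Colour : Set where
  red blue : Colour

_≟c_ : (x y : Colour) → Dec (x ≡ y)
red  ≟c red  = yes refl
red  ≟c blue = no λ ()
blue ≟c red  = no λ ()
blue ≟c blue = yes refl

-- A red/blue edge colouring of K_N on vertex set Fin N is a symmetric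
-- function col : Fin N → Fin N → Colour (diagonal values are irrelevant).
Colouring : ℕ → Set
Colouring N = Fin N → Fin N → Colour

Symmetric : ∀ {N} → Colouring N → Set
Symmetric {N} col = ∀ (x y : Fin N) → col x y ≡ col y x

deg : ∀ {N} → Colouring N → Colour → Fin N → ℕ
deg {N} col χ v =
  length (filter (λ w → ¬? (w FinP.≟ v) ×-dec (col v w ≟c χ)) (allFin N))

InRed : ∀ {N} → Colouring N → Fin N → Fin N → Set
InRed col v w = (w ≢ v) × (col v w ≡ red)

-- A red cycle on L vertices (L ≥ 2 intended) all lying in R(u):
-- an injective enumeration f : Fin L → Fin N of distinct vertices with
-- f i f (i+1) red for consecutive indices, cyclically (f (L-1) f 0 red).
CyclicSucc : ∀ {L} → Fin L → Fin L → Set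
CyclicSucc {L} i j =
  (toℕ j ≡ suc (toℕ i)) ⊎ ((suc (toℕ i) ≡ L) × (toℕ j ≡ 0))

RedCycleIn : ∀ {N} → Colouring N → (L : ℕ) → Fin N → Set
RedCycleIn {N} col L u =
  Σ (Fin L → Fin N) λ f →
    Injective _≡_ _≡_ f
    × (∀ i → InRed col u (f i))
    × (∀ i j → CyclicSucc i j → col (f i) (f j) ≡ red)

-- The linked double star S_c(n,m): vertices a_1..a_c (a zero .. a (c-1)),
-- v_1..v_n, w_1..w_m.
data SVert (c n m : ℕ) : Set where
  a : Fin c → SVert c n m
  v : Fin n → SVert c n m
  w : Fin m → SVert c n m

data SEdge : (c n m : ℕ) → SVert c n m → SVert c n m → Set where
  a₁v  : ∀ {c n m} (i : Fin n) → SEdge (suc c) n m (a zero) (v i)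
  path : ∀ {c n m} (j : Fin c) → SEdge (suc c) n m (a (inject₁ j)) (a (suc j))
  acw  : ∀ {c n m} (j : Fin m) → SEdge (suc c) n m (a (fromℕ c)) (w j)

CopyIn : ∀ {N} → Colouring N → Colour → (c n m : ℕ) → Set
CopyIn {N} col χ c n m =
  Σ (SVert c n m → Fin N) λ h →
    Injective _≡_ _≡_ h
    × (∀ x y → SEdge c n m x y → col (h x) (h y) ≡ χ)

MonoCopy : ∀ {N} → Colouring N → (c n m : ℕ) → Set
MonoCopy col c n m = CopyIn col red c n m ⊎ CopyIn col blue c n m

-- Let C be the red 2p-cycle inside A = R(u) and W the set of vertices outside C ∪ {u}, so
-- |W| ≥ 2n + 2m − 2, and u has at least |A| − 2p ≥ n + m red neighbours in W.
-- If some vertex x of C has m red neighbours in W, a red S_c(n,m) is the path that starts at u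
-- and runs once around C to x, with n leaves at u and m leaves at x, all chosen in W.
-- Otherwise every vertex of C has at least 2n + m − 1 blue neighbours in W, so any two consecutive
-- ones have at least 2n common blue neighbours there; a blue path alternating between
-- c₀, c₁, …, c_p and distinct such common neighbours then takes its leaves greedily among the
-- remaining blue neighbours of c₀ and c_p in W.
module Submission where

open import Defs
open import Data.Empty using (⊥-elim)
open import Data.Fin using (Fin; zero; suc; toℕ)
import Data.Fin.Properties as FinP
open import Data.List using (List; []; _∷_; _++_; length; filter; tabulate; allFin; applyUpTo)
open import Data.List.Membership.Propositional using (_∈_; _∉_)
open import Data.List.Membership.Propositional.Properties
  using (∈-tabulate⁺; ∈-applyUpTo⁺; ∈-++⁺ˡ; ∈-++⁺ʳ)
open import Data.List.Properties
  using (length-tabulate; length-applyUpTo; length-++; filter-accept; filter-all; filter-none)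
open import Data.List.Relation.Unary.All as All using (All; []; _∷_)
open import Data.List.Relation.Unary.All.Properties using (all-filter)
open import Data.List.Relation.Unary.Any using (here; there)
open import Data.List.Relation.Unary.Unique.Propositional using (Unique; []; _∷_)
open import Data.List.Relation.Unary.Unique.Propositional.Properties using (allFin⁺; filter⁺)
open import Data.Nat using (ℕ; zero; suc; _+_; _*_; _∸_; _≤_; _<_; z≤n; s≤s; _≤?_; NonZero)
open import Data.Nat.DivMod
  using (_%_; _/_; _mod_; m%n<n; m≡m%n+[m/n]*n; [m+kn]%n≡m%n; [m+n]%n≡m%n; m<n⇒m%n≡m; n%n≡0)
open import Data.Nat.Divisibility using (divides; ∣⇒≤; ∣m+n∣m⇒∣n; n∣m*n)
open import Data.Nat.Properties
open import Algebra.Properties.CommutativeSemigroup +-commutativeSemigroup using (xy∙z≈xz∙y)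
open import Data.Nat.Tactic.RingSolver using (solve-∀)
open import Data.Product using (∃; _×_; _,_; proj₁; proj₂)
open import Data.Sum using (_⊎_; inj₁; inj₂; [_,_])
open import Data.Unit using (tt)
open import Function using (_∘_)
open import Function.Definitions using (Injective)
open import Level using (Level; 0ℓ)
open import Relation.Nullary using (yes; no)
open import Relation.Unary using (Pred; Decidable; _⊆_; _∪_; _∩_; U)
open import Relation.Unary.Properties using (∁?; _∩?_)
open import Relation.Binary.PropositionalEquality
  using (_≡_; _≢_; refl; sym; trans; cong; cong₂; subst; subst₂; module ≡-Reasoning)

private
  variable
    ℓ ℓ₁ ℓ₂ : Level
    A : Set

∈∉⇒≢ : {x y : A} {zs : List A} → x ∈ zs → y ∉ zs → x ≢ y
∈∉⇒≢ x∈zs y∉zs refl = y∉zs x∈zs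

InjectiveBelow : ℕ → (ℕ → A) → Set
InjectiveBelow T g = ∀ {i j} → i < T → j < T → g i ≡ g j → i ≡ j

length-filter-∷ : {P : Pred A ℓ} (P? : Decidable P) (x : A) (xs : List A) →
                  length (filter P? xs) ≤ length (filter P? (x ∷ xs))
length-filter-∷ P? x xs with P? x
... | yes _ = n≤1+n _
... | no  _ = ≤-refl

length-filter-⊆-∪ : {P : Pred A ℓ} {Q : Pred A ℓ₁} {R : Pred A ℓ₂}
                    (P? : Decidable P) (Q? : Decidable Q) (R? : Decidable R) → P ⊆ Q ∪ R →
                    (xs : List A) → length (filter P? xs) ≤ length (filter Q? xs) + length (filter R? xs)
length-filter-⊆-∪ P? Q? R? P⊆Q∪R []       = z≤n
length-filter-⊆-∪ P? Q? R? P⊆Q∪R (x ∷ xs) with ih ← length-filter-⊆-∪ P? Q? R? P⊆Q∪R xs | P? x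
... | no _ = ≤-trans ih (+-mono-≤ (length-filter-∷ Q? x xs) (length-filter-∷ R? x xs))
... | yes px with P⊆Q∪R px
...   | inj₁ qx = begin
          suc (length (filter P? xs))
            ≤⟨ s≤s (≤-trans ih (+-monoʳ-≤ _ (length-filter-∷ R? x xs))) ⟩
          length (x ∷ filter Q? xs) + length (filter R? (x ∷ xs))
            ≡⟨ cong (λ l → length l + _) (filter-accept Q? qx) ⟨
          length (filter Q? (x ∷ xs)) + length (filter R? (x ∷ xs)) ∎
          where open ≤-Reasoning
...   | inj₂ rx = begin
          suc (length (filter P? xs))
            ≤⟨ s≤s (≤-trans ih (+-monoˡ-≤ _ (length-filter-∷ Q? x xs))) ⟩
          suc (length (filter Q? (x ∷ xs)) + length (filter R? xs))
            ≡⟨ +-suc _ _ ⟨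
          length (filter Q? (x ∷ xs)) + length (x ∷ filter R? xs)
            ≡⟨ cong (λ l → _ + length l) (filter-accept R? rx) ⟨
          length (filter Q? (x ∷ xs)) + length (filter R? (x ∷ xs)) ∎
          where open ≤-Reasoning

module Counting {N : ℕ} where

  open import Data.List.Membership.DecPropositional (FinP._≟_ {N}) using (_∈?_)

  count : {P : Pred (Fin N) ℓ} → Decidable P → ℕ
  count P? = length (filter P? (allFin N))

  count-⊆-∪ : {P : Pred (Fin N) ℓ} {Q : Pred (Fin N) ℓ₁} {R : Pred (Fin N) ℓ₂}
              (P? : Decidable P) (Q? : Decidable Q) (R? : Decidable R) →
              P ⊆ Q ∪ R → count P? ≤ count Q? + count R?
  count-⊆-∪ P? Q? R? P⊆Q∪R = length-filter-⊆-∪ P? Q? R? P⊆Q∪R (allFin N)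

  count-U : count {P = U} (λ _ → yes tt) ≡ N
  count-U = trans (cong length (filter-all (λ _ → yes tt) (All.universal-U (allFin N))))
                  (length-tabulate {n = N} _)

  count-≡ : (z : Fin N) → count (FinP._≟ z) ≤ 1
  count-≡ z = unique-constant (filter⁺ (FinP._≟ z) (allFin⁺ N)) (all-filter (FinP._≟ z) (allFin N))
    where
    unique-constant : ∀ {xs} → Unique xs → All (_≡ z) xs → length xs ≤ 1
    unique-constant []                  []              = z≤n
    unique-constant (_ ∷ [])            _               = s≤s z≤n
    unique-constant ((x≢y ∷ _) ∷ _ ∷ _) (x≡z ∷ y≡z ∷ _) = ⊥-elim (x≢y (trans x≡z (sym y≡z)))

  count-∈ : (zs : List (Fin N)) → count (_∈? zs) ≤ length zs
  count-∈ []       = ≤-reflexive (cong length (filter-none (_∈? []) (All.universal (λ _ ()) (allFin N))))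
  count-∈ (z ∷ zs) = ≤-trans (count-⊆-∪ (_∈? z ∷ zs) (FinP._≟ z) (_∈? zs) split)
                             (+-mono-≤ (count-≡ z) (count-∈ zs))
    where
    split : ∀ {y} → y ∈ z ∷ zs → y ≡ z ⊎ y ∈ zs
    split (here y≡z)   = inj₁ y≡z
    split (there y∈zs) = inj₂ y∈zs

  count-witness : {P : Pred (Fin N) ℓ} (P? : Decidable P) → 0 < count P? → ∃ P
  count-witness {P = P} P? = go (allFin N)
    where
    go : ∀ xs → 0 < length (filter P? xs) → ∃ P
    go (x ∷ xs) pos with P? x
    ... | yes px = x , px
    ... | no  _  = go xs pos

  length<count⇒∃∉ : {P : Pred (Fin N) ℓ} (P? : Decidable P) (zs : List (Fin N)) →
                    length zs < count P? → ∃ λ x → P x × x ∉ zs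
  length<count⇒∃∉ {P = P} P? zs |zs|<#P = count-witness P∖zs? (+-cancelʳ-≤ (length zs) 1 _ (begin
    suc (length zs)                ≤⟨ |zs|<#P ⟩
    count P?                       ≤⟨ count-⊆-∪ P? P∖zs? (_∈? zs) split ⟩
    count P∖zs? + count (_∈? zs)   ≤⟨ +-monoʳ-≤ _ (count-∈ zs) ⟩
    count P∖zs? + length zs        ∎))
    where
    open ≤-Reasoning
    P∖zs? : Decidable (λ y → P y × y ∉ zs)
    P∖zs? = P? ∩? ∁? (_∈? zs)
    split : ∀ {y} → P y → (P y × y ∉ zs) ⊎ y ∈ zs
    split {y} py with y ∈? zs
    ... | yes y∈zs = inj₂ y∈zs
    ... | no  y∉zs = inj₁ (py , y∉zs)

  record Representatives (T : ℕ) (S : ℕ → Pred (Fin N) ℓ) (zs : List (Fin N)) : Set ℓ where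
    field
      pick           : ℕ → Fin N
      pick-injective : InjectiveBelow T pick
      pick-∈         : ∀ {i} → i < T → S i (pick i)
      pick-∉         : ∀ {i} → i < T → pick i ∉ zs

  -- Greedy choice. Beyond T the picks are the junk value x₀.
  distinct-representatives :
    (x₀ : Fin N) (zs : List (Fin N)) (T : ℕ) {S : ℕ → Pred (Fin N) ℓ} (S? : ∀ i → Decidable (S i)) →
    (∀ {i} → i < T → length zs + suc i ≤ count (S? i)) → Representatives T S zs
  distinct-representatives x₀ zs zero S? _ = record
    { pick = λ _ → x₀ ; pick-injective = λ () ; pick-∈ = λ () ; pick-∉ = λ () }
  distinct-representatives x₀ zs (suc T) {S} S? large = record
    { pick = g ; pick-injective = g-injective ; pick-∈ = g-∈ ; pick-∉ = g-∉ }
    where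
    fresh : ∃ λ x → S 0 x × x ∉ zs
    fresh = length<count⇒∃∉ (S? 0) zs (subst (_≤ count (S? 0)) (+-comm (length zs) 1) (large (s≤s z≤n)))

    rest : Representatives T (S ∘ suc) (proj₁ fresh ∷ zs)
    rest = distinct-representatives x₀ (proj₁ fresh ∷ zs) T (S? ∘ suc)
             λ {i} i<T → ≤-trans (≤-reflexive (sym (+-suc (length zs) (suc i)))) (large (s≤s i<T))
    open Representatives rest

    g : ℕ → Fin N
    g zero    = proj₁ fresh
    g (suc i) = pick i

    g-injective : InjectiveBelow (suc T) g
    g-injective {zero}  {zero}  _  _  _  = refl
    g-injective {zero}  {suc j} _  j< eq = ⊥-elim (pick-∉ (≤-pred j<) (here (sym eq)))
    g-injective {suc i} {zero}  i< _  eq = ⊥-elim (pick-∉ (≤-pred i<) (here eq))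
    g-injective {suc i} {suc j} i< j< eq = cong suc (pick-injective (≤-pred i<) (≤-pred j<) eq)

    g-∈ : ∀ {i} → i < suc T → S i (g i)
    g-∈ {zero}  _  = proj₁ (proj₂ fresh)
    g-∈ {suc i} i< = pick-∈ (≤-pred i<)

    g-∉ : ∀ {i} → i < suc T → g i ∉ zs
    g-∉ {zero}  _  = proj₂ (proj₂ fresh)
    g-∉ {suc i} i< = pick-∉ (≤-pred i<) ∘ there

module CyclicWalk {X : Set} {L : ℕ} .{{_ : NonZero L}} (f : Fin L → X) where

  around : ℕ → X
  around t = f (t mod L)

  private
    toℕ-mod : ∀ x → toℕ (x mod L) ≡ x % L
    toℕ-mod x = FinP.toℕ-fromℕ< (m%n<n x L)

    mod-cong : ∀ {x y} → x % L ≡ y % L → x mod L ≡ y mod L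
    mod-cong {x} {y} eq = FinP.toℕ-injective (trans (toℕ-mod x) (trans eq (sym (toℕ-mod y))))

    %-suc : ∀ t → suc t % L ≡ suc (t % L) % L
    %-suc t = trans (cong (λ x → suc x % L) (m≡m%n+[m/n]*n t L)) ([m+kn]%n≡m%n (suc (t % L)) (t / L) L)

    %-suc-cases : ∀ t → (suc t % L ≡ suc (t % L)) ⊎ (suc (t % L) ≡ L × suc t % L ≡ 0)
    %-suc-cases t with m≤n⇒m<n∨m≡n (m%n<n t L)
    ... | inj₁ 1+r<L = inj₁ (trans (%-suc t) (m<n⇒m%n≡m 1+r<L))
    ... | inj₂ 1+r≡L = inj₂ (1+r≡L , trans (%-suc t) (trans (cong (_% L) 1+r≡L) (n%n≡0 L)))

    -- x and x + d agree mod L only if L ∣ d.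
    %-window : ∀ x d → d < L → x % L ≡ (x + d) % L → d ≡ 0
    %-window x zero      _   _  = refl
    %-window x d@(suc _) d<L eq =
      ⊥-elim (<⇒≱ d<L (∣⇒≤ (∣m+n∣m⇒∣n (divides ((x + d) / L) shift) (n∣m*n (x / L)))))
      where
      open ≡-Reasoning
      shift : x / L * L + d ≡ (x + d) / L * L
      shift = +-cancelˡ-≡ (x % L) _ _ (begin
        x % L + (x / L * L + d)       ≡⟨ +-assoc (x % L) _ d ⟨
        x % L + x / L * L + d         ≡⟨ cong (_+ d) (m≡m%n+[m/n]*n x L) ⟨
        x + d                         ≡⟨ m≡m%n+[m/n]*n (x + d) L ⟩
        (x + d) % L + (x + d) / L * L ≡⟨ cong (_+ (x + d) / L * L) eq ⟨
        x % L + (x + d) / L * L       ∎)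

  around-∈ : ∀ t → around t ∈ tabulate f
  around-∈ t = ∈-tabulate⁺ (t mod L)

  around-toℕ : ∀ i → around (toℕ i) ≡ f i
  around-toℕ i = cong f (FinP.toℕ-injective (trans (toℕ-mod (toℕ i)) (m<n⇒m%n≡m (FinP.toℕ<n i))))

  around-periodic : ∀ t → around (L + t) ≡ around t
  around-periodic t = cong f (mod-cong (trans (cong (_% L) (+-comm L t)) ([m+n]%n≡m%n t L)))

  around-step : {E : X → X → Set ℓ} → (∀ i j → CyclicSucc i j → E (f i) (f j)) →
                ∀ t → E (around t) (around (suc t))
  around-step f-cycle t = f-cycle (t mod L) (suc t mod L) mod-cyclic
    where
    mod-cyclic : CyclicSucc (t mod L) (suc t mod L)
    mod-cyclic = subst₂ (λ r r′ → (r′ ≡ suc r) ⊎ (suc r ≡ L × r′ ≡ 0))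
                        (sym (toℕ-mod t)) (sym (toℕ-mod (suc t))) (%-suc-cases t)

  private
    around-ordered : Injective _≡_ _≡_ f → ∀ J {s t} → s ≤ t → t < L →
                     around (s + J) ≡ around (t + J) → s ≡ t
    around-ordered f-inj J {s} {t} s≤t t<L eq = begin
      s           ≡⟨ +-identityʳ s ⟨
      s + 0       ≡⟨ cong (s +_) gap≡0 ⟨
      s + (t ∸ s) ≡⟨ m+[n∸m]≡n s≤t ⟩
      t           ∎
      where
      open ≡-Reasoning
      gap≡0 : t ∸ s ≡ 0
      gap≡0 = %-window (s + J) (t ∸ s) (≤-<-trans (m∸n≤m t s) t<L) (begin
        (s + J) % L           ≡⟨ toℕ-mod (s + J) ⟨
        toℕ ((s + J) mod L)   ≡⟨ cong toℕ (f-inj eq) ⟩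
        toℕ ((t + J) mod L)   ≡⟨ toℕ-mod (t + J) ⟩
        (t + J) % L           ≡⟨ cong (λ x → (x + J) % L) (m+[n∸m]≡n s≤t) ⟨
        (s + (t ∸ s) + J) % L ≡⟨ cong (_% L) (xy∙z≈xz∙y s (t ∸ s) J) ⟩
        (s + J + (t ∸ s)) % L ∎)

  around-injective : Injective _≡_ _≡_ f → ∀ J → InjectiveBelow L (λ t → around (t + J))
  around-injective f-inj J {s} {t} s<L t<L eq with ≤-total s t
  ... | inj₁ s≤t = around-ordered f-inj J s≤t t<L eq
  ... | inj₂ t≤s = sym (around-ordered f-inj J t≤s s<L (sym eq))

data Parity : ℕ → Set where
  even : ∀ k → Parity (2 * k)
  odd  : ∀ k → Parity (suc (2 * k))

parity : ∀ t → Parity t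
parity zero = even 0
parity (suc t) with parity t
... | even k = odd k
... | odd  k = subst Parity (*-suc 2 k) (even (suc k))

private
  half-≤ : ∀ {k P} → 2 * k < suc (2 * P) → k < suc P
  half-≤ h = s≤s (*-cancelˡ-≤ 2 (≤-pred h))

  half-< : ∀ {k P} → suc (2 * k) < suc (2 * P) → k < P
  half-< h = *-cancelˡ-< 2 _ _ (≤-pred h)

interleave : (ℕ → A) → (ℕ → A) → ℕ → A
interleave e o zero    = e 0
interleave e o (suc t) = interleave o (e ∘ suc) t

interleave-even : ∀ (e o : ℕ → A) k → interleave e o (2 * k) ≡ e k
interleave-even e o zero    = refl
interleave-even e o (suc k) = trans (cong (interleave e o) (*-suc 2 k)) (interleave-even (e ∘ suc) (o ∘ suc) k)

interleave-odd : ∀ (e o : ℕ → A) k → interleave e o (suc (2 * k)) ≡ o k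
interleave-odd e o = interleave-even o (e ∘ suc)

interleave-injective : ∀ {P} {e o : ℕ → A} → InjectiveBelow (suc P) e → InjectiveBelow P o →
                       (∀ {s t} → s < suc P → t < P → e s ≢ o t) →
                       InjectiveBelow (suc (2 * P)) (interleave e o)
interleave-injective {e = e} {o} e-inj o-inj e≢o {s} {t} s< t< eq with parity s | parity t
... | even k | even l = cong (2 *_) (e-inj (half-≤ s<) (half-≤ t<)
                          (trans (sym (interleave-even e o k)) (trans eq (interleave-even e o l))))
... | even k | odd  l = ⊥-elim (e≢o (half-≤ s<) (half-< t<)
                          (trans (sym (interleave-even e o k)) (trans eq (interleave-odd e o l))))
... | odd  k | even l = ⊥-elim (e≢o (half-≤ t<) (half-< s<)
                          (trans (sym (interleave-even e o l)) (trans (sym eq) (interleave-odd e o k))))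
... | odd  k | odd  l = cong (λ x → suc (2 * x)) (o-inj (half-< s<) (half-< t<)
                          (trans (sym (interleave-odd e o k)) (trans eq (interleave-odd e o l))))

interleave-step : ∀ {P} {e o : ℕ → A} (R : A → A → Set ℓ) →
                  (∀ {s} → s < P → R (e s) (o s)) → (∀ {s} → s < P → R (o s) (e (suc s))) →
                  ∀ {t} → t < 2 * P → R (interleave e o t) (interleave e o (suc t))
interleave-step {P = P} {e} {o} R e-o o-e {t} t< with parity t
... | even k = subst₂ R (sym (interleave-even e o k)) (sym (interleave-odd e o k))
                 (e-o (*-cancelˡ-< 2 k P t<))
... | odd  k = subst₂ R (sym (interleave-odd e o k)) (sym (interleave-even (e ∘ suc) (o ∘ suc) k))
                 (o-e (*-cancelˡ-< 2 k P (<-trans (n<1+n _) t<)))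

record SpineWithLeaves {N : ℕ} (col : Colouring N) (χ : Colour) (D n m : ℕ) : Set where
  field
    spine left right : ℕ → Fin N
    spine-injective  : InjectiveBelow (suc D) spine
    left-injective   : InjectiveBelow n left
    right-injective  : InjectiveBelow m right
    spine≢left       : ∀ {t i} → t < suc D → i < n → spine t ≢ left i
    spine≢right      : ∀ {t j} → t < suc D → j < m → spine t ≢ right j
    left≢right       : ∀ {i j} → i < n → j < m → left i ≢ right j
    spine-edge       : ∀ {t} → t < D → col (spine t) (spine (suc t)) ≡ χ
    left-edge        : ∀ {i} → i < n → col (spine 0) (left i) ≡ χ
    right-edge       : ∀ {j} → j < m → col (spine D) (right j) ≡ χ

  copy : CopyIn col χ (suc D) n m
  copy = h , h-injective , h-edge
    where
    open FinP using (toℕ<n)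

    h : SVert (suc D) n m → Fin N
    h (a t) = spine (toℕ t)
    h (v i) = left (toℕ i)
    h (w j) = right (toℕ j)

    h-injective : Injective _≡_ _≡_ h
    h-injective {a s} {a t} eq = cong a (FinP.toℕ-injective (spine-injective (toℕ<n s) (toℕ<n t) eq))
    h-injective {v i} {v j} eq = cong v (FinP.toℕ-injective (left-injective (toℕ<n i) (toℕ<n j) eq))
    h-injective {w i} {w j} eq = cong w (FinP.toℕ-injective (right-injective (toℕ<n i) (toℕ<n j) eq))
    h-injective {a t} {v i} eq = ⊥-elim (spine≢left (toℕ<n t) (toℕ<n i) eq)
    h-injective {v i} {a t} eq = ⊥-elim (spine≢left (toℕ<n t) (toℕ<n i) (sym eq))
    h-injective {a t} {w j} eq = ⊥-elim (spine≢right (toℕ<n t) (toℕ<n j) eq)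
    h-injective {w j} {a t} eq = ⊥-elim (spine≢right (toℕ<n t) (toℕ<n j) (sym eq))
    h-injective {v i} {w j} eq = ⊥-elim (left≢right (toℕ<n i) (toℕ<n j) eq)
    h-injective {w j} {v i} eq = ⊥-elim (left≢right (toℕ<n i) (toℕ<n j) (sym eq))

    h-edge : ∀ x y → SEdge (suc D) n m x y → col (h x) (h y) ≡ χ
    h-edge _ _ (a₁v i)  = left-edge (toℕ<n i)
    h-edge _ _ (path j) rewrite FinP.toℕ-inject₁ j = spine-edge (toℕ<n j)
    h-edge _ _ (acw j)  rewrite FinP.toℕ-fromℕ D   = right-edge (toℕ<n j)

module RedCycle {N L′ : ℕ} (col : Colouring N) (u : Fin N) (f : Fin (suc L′) → Fin N)
  (f-injective : Injective _≡_ _≡_ f) (f-red : ∀ i → InRed col u (f i))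
  (f-cycle : ∀ i j → CyclicSucc i j → col (f i) (f j) ≡ red) where

  open Counting {N}
  open CyclicWalk f
  open import Data.List.Membership.DecPropositional (FinP._≟_ {N}) using (_∈?_)

  L : ℕ
  L = suc L′

  cycle : List (Fin N)
  cycle = tabulate f

  Outside : Pred (Fin N) 0ℓ
  Outside y = y ∉ u ∷ cycle

  outside? : Decidable Outside
  outside? = ∁? (_∈? (u ∷ cycle))

  OutsideNeighbour : Fin N → Colour → Pred (Fin N) 0ℓ
  OutsideNeighbour x χ = Outside ∩ λ y → col x y ≡ χ

  outsideNeighbour? : (x : Fin N) (χ : Colour) → Decidable (OutsideNeighbour x χ)
  outsideNeighbour? x χ = outside? ∩? (λ y → col x y ≟c χ)

  deg-outside : Fin N → Colour → ℕ
  deg-outside x χ = count (outsideNeighbour? x χ)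

  around-∈-cycle : ∀ t → around t ∈ u ∷ cycle
  around-∈-cycle t = there (around-∈ t)

  count-outside : N ≤ count outside? + suc L
  count-outside = begin
    N                                        ≡⟨ count-U ⟨
    count {P = U} (λ _ → yes tt)             ≤⟨ count-⊆-∪ _ outside? (_∈? (u ∷ cycle)) (λ _ → split _) ⟩
    count outside? + count (_∈? (u ∷ cycle)) ≤⟨ +-monoʳ-≤ _ (count-∈ (u ∷ cycle)) ⟩
    count outside? + suc (length cycle)      ≡⟨ cong (λ l → count outside? + suc l) (length-tabulate f) ⟩
    count outside? + suc L                   ∎
    where
    open ≤-Reasoning
    split : ∀ y → Outside y ⊎ y ∈ u ∷ cycle
    split y with y ∈? (u ∷ cycle)
    ... | yes y∈ = inj₂ y∈
    ... | no  y∉ = inj₁ y∉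

  count-outside≤deg-outside : ∀ x → count outside? ≤ deg-outside x blue + deg-outside x red
  count-outside≤deg-outside x =
    count-⊆-∪ outside? (outsideNeighbour? x blue) (outsideNeighbour? x red) by-colour
    where
    by-colour : ∀ {y} → Outside y → OutsideNeighbour x blue y ⊎ OutsideNeighbour x red y
    by-colour {y} out with col x y
    ... | blue = inj₁ (out , refl)
    ... | red  = inj₂ (out , refl)

  deg-red-u≤ : deg col red u ≤ deg-outside u red + L
  deg-red-u≤ = ≤-trans (count-⊆-∪ _ (outsideNeighbour? u red) (_∈? cycle) split)
                       (+-monoʳ-≤ _ (≤-trans (count-∈ cycle) (≤-reflexive (length-tabulate f))))
    where
    split : ∀ {y} → y ≢ u × col u y ≡ red → OutsideNeighbour u red y ⊎ y ∈ cycle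
    split {y} (y≢u , uy-red) with y ∈? cycle
    ... | yes y∈ = inj₂ y∈
    ... | no  y∉ = inj₁ ((λ { (here y≡u) → y≢u y≡u ; (there y∈) → y∉ y∈ }) , uy-red)

  -- The spine is u followed by the whole cycle, entered just after around J and ending at it.
  red-copy : ∀ {n m} J → m ≤ deg-outside (around J) red → n + m ≤ deg-outside u red →
             CopyIn col red (suc L) n m
  red-copy {n} {m} J right-room left-room = SpineWithLeaves.copy layout
    where
    spine : ℕ → Fin N
    spine zero    = u
    spine (suc t) = around (t + suc J)

    spine-∈ : ∀ t → spine t ∈ u ∷ cycle
    spine-∈ zero    = here refl
    spine-∈ (suc t) = around-∈-cycle (t + suc J)

    spine-end : spine L ≡ around J
    spine-end = trans (cong around (+-suc L′ J)) (around-periodic J)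

    spine-injective : InjectiveBelow (suc L) spine
    spine-injective {zero}  {zero}  _  _  _  = refl
    spine-injective {zero}  {suc t} _  _  eq = ⊥-elim (proj₁ (f-red _) (sym eq))
    spine-injective {suc s} {zero}  _  _  eq = ⊥-elim (proj₁ (f-red _) eq)
    spine-injective {suc s} {suc t} s< t< eq =
      cong suc (around-injective f-injective (suc J) (≤-pred s<) (≤-pred t<) eq)

    spine-edge : ∀ {t} → t < L → col (spine t) (spine (suc t)) ≡ red
    spine-edge {zero}  _ = proj₂ (f-red _)
    spine-edge {suc t} _ = around-step {E = λ x y → col x y ≡ red} f-cycle (t + suc J)

    rights : Representatives m (λ _ → OutsideNeighbour (around J) red) []
    rights = distinct-representatives u [] m (λ _ → outsideNeighbour? (around J) red)
               λ j<m → ≤-trans j<m right-room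
    open Representatives rights
      renaming (pick to right; pick-injective to right-injective; pick-∈ to right-∈)

    lefts : Representatives n (λ _ → OutsideNeighbour u red) (applyUpTo right m)
    lefts = distinct-representatives u (applyUpTo right m) n (λ _ → outsideNeighbour? u red)
      λ {i} i<n → begin
        length (applyUpTo right m) + suc i ≡⟨ cong (_+ suc i) (length-applyUpTo right m) ⟩
        m + suc i                          ≤⟨ +-monoʳ-≤ m i<n ⟩
        m + n                              ≡⟨ +-comm m n ⟩
        n + m                              ≤⟨ left-room ⟩
        deg-outside u red                  ∎
      where open ≤-Reasoning
    open Representatives lefts
      renaming (pick to left; pick-injective to left-injective; pick-∈ to left-∈; pick-∉ to left-∉)

    layout : SpineWithLeaves col red L n m
    layout = record
      { spine           = spine
      ; left            = left
      ; right           = right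
      ; spine-injective = spine-injective
      ; left-injective  = left-injective
      ; right-injective = right-injective
      ; spine≢left      = λ {t} _ i<n → ∈∉⇒≢ (spine-∈ t) (proj₁ (left-∈ i<n))
      ; spine≢right     = λ {t} _ j<m → ∈∉⇒≢ (spine-∈ t) (proj₁ (right-∈ j<m))
      ; left≢right      = λ i<n j<m eq →
                            left-∉ i<n (subst (_∈ applyUpTo right m) (sym eq) (∈-applyUpTo⁺ right j<m))
      ; spine-edge      = spine-edge
      ; left-edge       = λ i<n → proj₂ (left-∈ i<n)
      ; right-edge      = λ {j} j<m →
                            subst (λ x → col x (right j) ≡ red) (sym spine-end) (proj₂ (right-∈ j<m))
      }

  blue-copy : Symmetric col → ∀ {n m} P → P < L → suc P ≤ n →
              n + m + n + m ≤ 2 + count outside? →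
              (∀ t → suc (deg-outside (around t) red) ≤ m) →
              CopyIn col blue (suc (2 * P)) n m
  blue-copy col-sym {n} {m} P P<L P<n many-outside few-red = SpineWithLeaves.copy layout
    where
    open ≤-Reasoning

    many-blue : ∀ t → n + m + n ≤ suc (deg-outside (around t) blue)
    many-blue t = +-cancelʳ-≤ m _ _ (begin
      n + m + n + m                       ≤⟨ many-outside ⟩
      2 + count outside?                  ≤⟨ +-monoʳ-≤ 2 (count-outside≤deg-outside (around t)) ⟩
      2 + (deg-outside (around t) blue + deg-outside (around t) red)
        ≡⟨ cong suc (+-suc _ _) ⟨
      suc (deg-outside (around t) blue) + suc (deg-outside (around t) red)
        ≤⟨ +-monoʳ-≤ _ (few-red t) ⟩
      suc (deg-outside (around t) blue) + m ∎)

    Common : ℕ → Pred (Fin N) 0ℓ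
    Common s = OutsideNeighbour (around s) blue ∩ λ y → col (around (suc s)) y ≡ blue

    common? : ∀ s → Decidable (Common s)
    common? s = outsideNeighbour? (around s) blue ∩? (λ y → col (around (suc s)) y ≟c blue)

    many-common : ∀ s → n ≤ count (common? s)
    many-common s = +-cancelʳ-≤ m n _ (begin
      n + m                                ≤⟨ m≤m+n (n + m) n ⟩
      n + m + n                            ≤⟨ many-blue s ⟩
      suc (deg-outside (around s) blue)
        ≤⟨ s≤s (count-⊆-∪ _ (common? s) (outsideNeighbour? (around (suc s)) red) split) ⟩
      suc (count (common? s) + deg-outside (around (suc s)) red)
        ≡⟨ +-suc _ _ ⟨
      count (common? s) + suc (deg-outside (around (suc s)) red)
        ≤⟨ +-monoʳ-≤ _ (few-red (suc s)) ⟩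
      count (common? s) + m                ∎)
      where
      split : ∀ {y} → OutsideNeighbour (around s) blue y →
              Common s y ⊎ OutsideNeighbour (around (suc s)) red y
      split {y} out-blue with col (around (suc s)) y
      ... | blue = inj₁ (out-blue , refl)
      ... | red  = inj₂ (proj₁ out-blue , refl)

    middles : Representatives P Common []
    middles = distinct-representatives u [] P common?
                λ {s} s<P → ≤-trans s<P (≤-trans (<⇒≤ P<n) (many-common s))
    open Representatives middles
      renaming (pick to middle; pick-injective to middle-injective; pick-∈ to middle-∈)

    rights : Representatives m (λ _ → OutsideNeighbour (around P) blue) (applyUpTo middle P)
    rights = distinct-representatives u (applyUpTo middle P) m (λ _ → outsideNeighbour? (around P) blue)
      λ {j} j<m → begin
        length (applyUpTo middle P) + suc j ≡⟨ cong (_+ suc j) (length-applyUpTo middle P) ⟩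
        P + suc j                           ≤⟨ +-monoʳ-≤ P j<m ⟩
        P + m                               ≤⟨ ≤-pred (≤-trans (+-monoˡ-≤ m P<n)
                                                 (≤-trans (m≤m+n (n + m) n) (many-blue P))) ⟩
        deg-outside (around P) blue         ∎
    open Representatives rights
      renaming (pick to right; pick-injective to right-injective; pick-∈ to right-∈; pick-∉ to right-∉)

    used : List (Fin N)
    used = applyUpTo middle P ++ applyUpTo right m

    lefts : Representatives n (λ _ → OutsideNeighbour (around 0) blue) used
    lefts = distinct-representatives u used n (λ _ → outsideNeighbour? (around 0) blue)
      λ {i} i<n → begin
        length used + suc i          ≡⟨ cong (_+ suc i) (trans (length-++ (applyUpTo middle P))
                                          (cong₂ _+_ (length-applyUpTo middle P) (length-applyUpTo right m))) ⟩
        P + m + suc i                ≤⟨ +-monoʳ-≤ (P + m) i<n ⟩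
        P + m + n                    ≤⟨ ≤-pred (≤-trans (+-monoˡ-≤ n (+-monoˡ-≤ m P<n)) (many-blue 0)) ⟩
        deg-outside (around 0) blue  ∎
    open Representatives lefts
      renaming (pick to left; pick-injective to left-injective; pick-∈ to left-∈; pick-∉ to left-∉)

    spine : ℕ → Fin N
    spine = interleave around middle

    around-injective-≤P : InjectiveBelow (suc P) around
    around-injective-≤P {s} {t} s≤P t≤P eq =
      around-injective f-injective 0 (≤-<-trans (≤-pred s≤P) P<L) (≤-<-trans (≤-pred t≤P) P<L)
        (subst₂ (λ x y → around x ≡ around y) (sym (+-identityʳ s)) (sym (+-identityʳ t)) eq)

    spine-∈ : ∀ {t} → t < suc (2 * P) → spine t ∈ u ∷ cycle ⊎ spine t ∈ applyUpTo middle P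
    spine-∈ {t} t< with parity t
    ... | even k = inj₁ (subst (_∈ u ∷ cycle) (sym (interleave-even around middle k)) (around-∈-cycle k))
    ... | odd  k = inj₂ (subst (_∈ applyUpTo middle P) (sym (interleave-odd around middle k))
                                (∈-applyUpTo⁺ middle (half-< t<)))

    spine≢left : ∀ {t i} → t < suc (2 * P) → i < n → spine t ≢ left i
    spine≢left t< i<n = [ (λ ∈cycle   → ∈∉⇒≢ ∈cycle (proj₁ (left-∈ i<n)))
                        , (λ ∈middles → ∈∉⇒≢ (∈-++⁺ˡ ∈middles) (left-∉ i<n)) ] (spine-∈ t<)

    spine≢right : ∀ {t j} → t < suc (2 * P) → j < m → spine t ≢ right j
    spine≢right t< j<m = [ (λ ∈cycle   → ∈∉⇒≢ ∈cycle (proj₁ (right-∈ j<m)))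
                         , (λ ∈middles → ∈∉⇒≢ ∈middles (right-∉ j<m)) ] (spine-∈ t<)

    layout : SpineWithLeaves col blue (2 * P) n m
    layout = record
      { spine           = spine
      ; left            = left
      ; right           = right
      ; spine-injective = interleave-injective around-injective-≤P middle-injective
                            λ {s} _ t<P → ∈∉⇒≢ (around-∈-cycle s) (proj₁ (proj₁ (middle-∈ t<P)))
      ; left-injective  = left-injective
      ; right-injective = right-injective
      ; spine≢left      = spine≢left
      ; spine≢right     = spine≢right
      ; left≢right      = λ i<n j<m eq → left-∉ i<n
                            (subst (_∈ used) (sym eq) (∈-++⁺ʳ (applyUpTo middle P) (∈-applyUpTo⁺ right j<m)))
      ; spine-edge      = interleave-step (λ x y → col x y ≡ blue)
                            (λ s<P → proj₂ (proj₁ (middle-∈ s<P)))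
                            (λ {s} s<P → trans (col-sym (middle s) (around (suc s))) (proj₂ (middle-∈ s<P)))
      ; left-edge       = λ i<n → proj₂ (left-∈ i<n)
      ; right-edge      = λ {j} j<m → subst (λ x → col x (right j) ≡ blue)
                                         (sym (interleave-even around middle P)) (proj₂ (right-∈ j<m))
      }

  monochromatic-copy : Symmetric col → ∀ {n m} P → 2 * P ≡ L → P < L → suc P ≤ n →
                       n + m ≤ deg-outside u red → n + m + n + m ≤ 2 + count outside? →
                       MonoCopy col (suc L) n m
  monochromatic-copy col-sym {n} {m} P 2P≡L P<L P<n many-red-at-u many-outside
    with FinP.any? (λ j → m ≤? deg-outside (f j) red)
  ... | yes (j , m≤) =
        inj₁ (red-copy (toℕ j) (subst (λ x → m ≤ deg-outside x red) (sym (around-toℕ j)) m≤) many-red-at-u)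
  ... | no  none     =
        inj₂ (subst (λ D → CopyIn col blue (suc D) n m) 2P≡L
               (blue-copy col-sym P P<L P<n many-outside λ t → ≰⇒> λ m≤ → none (t mod L , m≤)))

lemma3p7 : (p n m : ℕ) → 1 ≤ p → 1 ≤ m → m ≤ n → suc p ≤ n
    → (col : Colouring (2 * (n + m + p) ∸ 1)) → Symmetric col
    → (u : Fin (2 * (n + m + p) ∸ 1))
    → (∀ x → deg col red x ≤ deg col red u)
    → (∀ x → deg col blue x ≤ deg col red u)
    → (k : ℕ) → deg col red u ≡ n + m + p ∸ 1 + k
    → suc p ≤ k
    → RedCycleIn col (2 * p) u
    → MonoCopy col (suc (2 * p)) n m
lemma3p7 p@(suc p′) n m _ _ _ p<n col col-sym u _ _ k deg-u p<k (f , f-injective , f-red , f-cycle) =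
  monochromatic-copy col-sym p refl (m<m+n p (s≤s z≤n)) p<n many-red-at-u many-outside
  where
  open Counting
  open RedCycle col u f f-injective f-red f-cycle
  open ≤-Reasoning

  rearrange-red : ∀ a q → a + 2 * suc q ≡ a + q + suc (suc q)
  rearrange-red = solve-∀

  rearrange-outside : ∀ a b q → a + b + a + b + 2 * q ≡ 2 * (a + b + q)
  rearrange-outside = solve-∀

  many-red-at-u : n + m ≤ deg-outside u red
  many-red-at-u = +-cancelʳ-≤ (2 * p) (n + m) _ (begin
    n + m + 2 * p              ≡⟨ rearrange-red (n + m) p′ ⟩
    n + m + p′ + suc p         ≤⟨ +-monoʳ-≤ _ p<k ⟩
    n + m + p′ + k             ≡⟨ cong (λ x → x ∸ 1 + k) (+-suc (n + m) p′) ⟨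
    n + m + p ∸ 1 + k          ≡⟨ deg-u ⟨
    deg col red u              ≤⟨ deg-red-u≤ ⟩
    deg-outside u red + 2 * p  ∎)

  many-outside : n + m + n + m ≤ 2 + count outside?
  many-outside = +-cancelʳ-≤ (2 * p) _ _ (begin
    n + m + n + m + 2 * p               ≡⟨ rearrange-outside n m p ⟩
    2 * (n + m + p)                     ≤⟨ m≤n+m∸n (2 * (n + m + p)) 1 ⟩
    suc (2 * (n + m + p) ∸ 1)           ≤⟨ s≤s count-outside ⟩
    suc (count outside? + suc (2 * p))  ≡⟨ cong suc (+-suc _ (2 * p)) ⟩
    2 + count outside? + 2 * p          ∎)
lemma3p7 zero _ _ () _ _ _ _ _ _ _ _ _ _ _
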